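{- Let $m>1$ be an integer, let $k$ be a nonzero integer, let $a_1,\dots,a_n$ be nonzero integers, and let $p(x_1,\dots,x_n)=\sum_{i=1}^n a_ix_i+km$. Put $\sigma_j=\sum_{i=1}^j a_i$ for $j\le n$. Assume that either $k=-1$ or there exists $j\in\{1,\dots,n\}$ with $\sigma_j=1$. Then the following are equivalent: (a) there exists a numerical semigroup of multiplicity $m$ that admits $p$; (b) the ordinary semigroup $\{0,m,\to\}=\{0\}\cup\{m,m+1,\dots\}$ admits $p$; (c) $\sigma_j\geq 0$ for all $j\leq n$, and $\sigma_n+k\geq 1$.
   Context: A numerical semigroup is a subset $\Lambda\subseteq\mathbb N_0$ containing $0$, closed under addition, with $\mathbb N_0\setminus\Lambda$ finite; its multiplicity is its smallest nonzero element. A numerical semigroup $\Lambda$ admits $p$ if for every $n$ nonzero elements $s_1\geq s_2\geq\cdots\geq s_n$ of $\Lambda$ the integer $p(s_1,\dots,s_n)$ belongs to $\Lambda$. -}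

module Defs where

open import Data.Nat using (ℕ; zero; suc; _<_; _≤_; _≥_)
open import Data.Integer as ℤ using (ℤ; +_)
open import Data.Fin using (Fin; zero; suc)
import Data.Fin as Fin
open import Data.Product using (Σ; ∃; _×_)
open import Data.Sum using (_⊎_)
open import Relation.Binary.PropositionalEquality using (_≡_; _≢_)
open import Relation.Nullary using (¬_)

Subset : Set₁
Subset = ℕ → Set

record IsNumericalSemigroup (Λ : Subset) : Set where
  field
    has-zero : Λ 0
    closed   : ∀ x y → Λ x → Λ y → Λ (x Data.Nat.+ y)
    cofinite : ∃ λ N → ∀ x → N ≤ x → Λ x

HasMultiplicity : Subset → ℕ → Set
HasMultiplicity Λ m = (0 < m) × Λ m × (∀ x → 0 < x → x < m → ¬ Λ x)

_∈ℤ_ : ℤ → Subset → Set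
z ∈ℤ Λ = Σ ℕ λ x → (z ≡ + x) × Λ x

linSum : ∀ {n} → (Fin n → ℤ) → (Fin n → ℕ) → ℤ
linSum {zero}  a s = + 0
linSum {suc n} a s = a zero ℤ.* (+ s zero) ℤ.+ linSum (λ i → a (suc i)) (λ i → s (suc i))

evalP : ∀ {n} → (Fin n → ℤ) → ℤ → ℕ → (Fin n → ℕ) → ℤ
evalP a k m s = linSum a s ℤ.+ k ℤ.* (+ m)

Admits : ∀ {n} → Subset → (Fin n → ℤ) → ℤ → ℕ → Set
Admits {n} Λ a k m =
  (s : Fin n → ℕ) →
  (∀ i → Λ (s i)) →
  (∀ i → 0 < s i) →
  (∀ i j → i Fin.≤ j → s j ≤ s i) →
  evalP a k m s ∈ℤ Λ

-- σⱼ = ∑_{i ≤ j} aᵢ, indexed by j ∈ {0,…,n} (σ₀ = 0).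
σ : ∀ {n} → (Fin n → ℤ) → Fin (suc n) → ℤ
σ {n}     a zero = + 0
σ {suc n} a (suc j) = a zero ℤ.+ σ (λ i → a (suc i)) j

Ordinary : ℕ → Subset
Ordinary m x = (x ≡ 0) ⊎ (m ≤ x)

module Submission where

-- Write σⱼ for the prefix sums of a and σ = σₙ for the total.
-- Everything rests on evaluating p at "two-level" sequences: the first c
-- arguments equal x + t and the remaining ones equal x.  For these
--   p(s) = σ x + k m + σ_c t                                  (evalP-twoLevel).
-- Necessity, for any numerical semigroup Λ of multiplicity m admitting p:
--   * if some σ_c < 0, take x beyond the conductor of Λ and t huge: p(s) < 0;
--   * if σ + k < 0, the constant sequence m gives p(s) = (σ + k) m < 0;
--   * if σ + k = 0, the hypothesis provides c with σ_c = 1, so p sends the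
--     two-level sequence (x = m) to t: from m + t ∈ Λ we get t ∈ Λ, and
--     descending from 1 + m N ∈ Λ puts the gap 1 into Λ, contradicting m > 1.
-- Sufficiency: by Abel summation, nonnegative prefix sums give σ L ≤ ∑ aᵢ sᵢ
-- for every nonincreasing s bounded below by L; with L = m this yields
-- p(s) ≥ (σ + k) m ≥ m, so {0, m, →} admits p.  Since {0, m, →} is itself a
-- numerical semigroup of multiplicity m, both equivalences follow.

open import Defs
open import Data.Nat using (ℕ; _<_)
import Data.Nat as ℕ
open import Data.Integer using (ℤ; +_; -[1+_]; _≤_; _+_)
open import Data.Fin using (Fin; fromℕ; suc)
open import Data.Product using (∃; _×_)
open import Data.Sum using (_⊎_)
open import Relation.Binary.PropositionalEquality using (_≡_; _≢_)
open import Function.Bundles using (_⇔_)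

open import Data.Nat using (zero; suc; z≤n; s≤s)
import Data.Nat.Properties as ℕP
open import Data.Integer using (_*_; _-_; +≤+; -≤-; -≤+; ∣_∣; nonNegative)
import Data.Integer.Properties as ℤP
open import Data.Integer.Tactic.RingSolver using (solve-∀)
import Data.Fin as Fin
open import Data.Product using (_,_; proj₁; proj₂)
open import Data.Sum using (inj₁; inj₂)
open import Data.Empty using (⊥-elim)
open import Relation.Nullary using (¬_)
open import Relation.Binary.PropositionalEquality
  using (refl; sym; trans; cong; cong₂; subst; subst₂)
open import Function.Bundles using (mk⇔)

Nonincreasing : ∀ {n} → (Fin n → ℕ) → Set
Nonincreasing s = ∀ i j → i Fin.≤ j → s j ℕ.≤ s i

≤-1⇒∉ : ∀ {z} {Λ : Subset} → z ≤ -[1+ 0 ] → ¬ (z ∈ℤ Λ)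
≤-1⇒∉ z≤-1 (x , refl , _) with z≤-1
... | ()

sign-split : ∀ z → + 0 ≤ z ⊎ z ≤ -[1+ 0 ]
sign-split (+ n)    = inj₁ (+≤+ z≤n)
sign-split -[1+ n ] = inj₂ (-≤- z≤n)

positive-split : ∀ z → + 1 ≤ z ⊎ z ≡ + 0 ⊎ z ≤ -[1+ 0 ]
positive-split (+ zero)  = inj₂ (inj₁ refl)
positive-split (+ suc n) = inj₁ (+≤+ (s≤s z≤n))
positive-split -[1+ n ]  = inj₂ (inj₂ (-≤- z≤n))

-- Two-level sequences

twoLevel : ∀ {n} → Fin (suc n) → ℕ → ℕ → Fin n → ℕ
twoLevel Fin.zero x t i        = x
twoLevel (suc c) x t Fin.zero  = x ℕ.+ t
twoLevel (suc c) x t (suc i)   = twoLevel c x t i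

twoLevel-≥ : ∀ {n} (c : Fin (suc n)) x t i → x ℕ.≤ twoLevel c x t i
twoLevel-≥ Fin.zero x t i       = ℕP.≤-refl
twoLevel-≥ (suc c) x t Fin.zero = ℕP.m≤m+n x t
twoLevel-≥ (suc c) x t (suc i)  = twoLevel-≥ c x t i

twoLevel-≤ : ∀ {n} (c : Fin (suc n)) x t i → twoLevel c x t i ℕ.≤ x ℕ.+ t
twoLevel-≤ Fin.zero x t i       = ℕP.m≤m+n x t
twoLevel-≤ (suc c) x t Fin.zero = ℕP.≤-refl
twoLevel-≤ (suc c) x t (suc i)  = twoLevel-≤ c x t i

twoLevel-values : ∀ {n} (c : Fin (suc n)) x t i →
  twoLevel c x t i ≡ x ⊎ twoLevel c x t i ≡ x ℕ.+ t
twoLevel-values Fin.zero x t i       = inj₁ refl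
twoLevel-values (suc c) x t Fin.zero = inj₂ refl
twoLevel-values (suc c) x t (suc i)  = twoLevel-values c x t i

twoLevel-nonincreasing : ∀ {n} (c : Fin (suc n)) x t → Nonincreasing (twoLevel {n} c x t)
twoLevel-nonincreasing Fin.zero x t i j _                  = ℕP.≤-refl
twoLevel-nonincreasing (suc c) x t Fin.zero Fin.zero _     = ℕP.≤-refl
twoLevel-nonincreasing (suc c) x t Fin.zero (suc j) _      = twoLevel-≤ c x t j
twoLevel-nonincreasing (suc c) x t (suc i) (suc j) (s≤s p) = twoLevel-nonincreasing c x t i j p

linSum-twoLevel : ∀ {n} (a : Fin n → ℤ) (c : Fin (suc n)) x t →
  linSum a (twoLevel c x t) ≡ σ a (fromℕ n) * + x + σ a c * + t
linSum-twoLevel {zero}  a Fin.zero x t = refl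
linSum-twoLevel {suc n} a Fin.zero x t =
  trans (cong (_+_ (a Fin.zero * + x)) (linSum-twoLevel a′ Fin.zero x t))
        (distrib (a Fin.zero) (σ a′ (fromℕ n)) (+ x))
  where
  a′ : Fin n → ℤ
  a′ i = a (suc i)
  distrib : ∀ b u y → b * y + (u * y + + 0 * + t) ≡ (b + u) * y + + 0 * + t
  distrib = solve-∀
linSum-twoLevel {suc n} a (suc c) x t =
  trans (cong₂ _+_ (cong (a Fin.zero *_) (ℤP.pos-+ x t)) (linSum-twoLevel a′ c x t))
        (regroup (a Fin.zero) (+ x) (+ t) (σ a′ (fromℕ n)) (σ a′ c))
  where
  a′ : Fin n → ℤ
  a′ i = a (suc i)
  regroup : ∀ b y u v w → b * (y + u) + (v * y + w * u) ≡ (b + v) * y + (b + w) * u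
  regroup = solve-∀

evalP-twoLevel : ∀ {n} (a : Fin n → ℤ) k m (c : Fin (suc n)) x t →
  evalP a k m (twoLevel c x t) ≡ (σ a (fromℕ n) * + x + k * + m) + σ a c * + t
evalP-twoLevel {n} a k m c x t =
  trans (cong (_+ k * + m) (linSum-twoLevel a c x t))
        (swap (σ a (fromℕ n) * + x) (σ a c * + t) (k * + m))
  where
  swap : ∀ u v w → (u + v) + w ≡ (u + w) + v
  swap = solve-∀

-- Abel summation

-- The shift c itself is the prefix sum c + σ₀.
shift-≥0 : ∀ {n} (a : Fin n → ℤ) c → (∀ j → + 0 ≤ c + σ a j) → + 0 ≤ c
shift-≥0 a c shifted-≥0 = subst (+ 0 ≤_) (ℤP.+-identityʳ c) (shifted-≥0 Fin.zero)

-- Inductive form of summation by parts: if every shifted prefix sum c + σⱼ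
-- (including c + σ₀ = c) is nonnegative, then for s nonincreasing with L ≤ sᵢ ≤ B,
--   (c + σₙ) L ≤ c B + ∑ aᵢ sᵢ.
abel-shifted : ∀ {n} (a : Fin n → ℤ) (s : Fin n → ℕ) (c : ℤ) (B L : ℕ) →
  (∀ j → + 0 ≤ c + σ a j) → Nonincreasing s →
  (∀ i → L ℕ.≤ s i) → (∀ i → s i ℕ.≤ B) → L ℕ.≤ B →
  (c + σ a (fromℕ n)) * + L ≤ c * + B + linSum a s
abel-shifted {zero} a s c B L shifted-≥0 _ _ _ L≤B =
  subst₂ _≤_ (cong (_* + L) (sym (ℤP.+-identityʳ c))) (sym (ℤP.+-identityʳ _))
    (ℤP.*-monoˡ-≤-nonNeg c {{nonNegative (shift-≥0 a c shifted-≥0)}} (+≤+ L≤B))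
abel-shifted {suc n} a s c B L shifted-≥0 noninc lower upper _ = begin
  (c + (a₀ + σ a′ (fromℕ n))) * + L ≡⟨ cong (_* + L) (ℤP.+-assoc c a₀ _) ⟨
  (c′ + σ a′ (fromℕ n)) * + L       ≤⟨ induction ⟩
  c′ * + s₀ + linSum a′ s′          ≡⟨ expand c a₀ (+ s₀) (linSum a′ s′) ⟩
  c * + s₀ + (a₀ * + s₀ + linSum a′ s′)
    ≤⟨ ℤP.+-monoˡ-≤ _ (ℤP.*-monoˡ-≤-nonNeg c {{nonNegative (shift-≥0 a c shifted-≥0)}} (+≤+ (upper Fin.zero))) ⟩
  c * + B + (a₀ * + s₀ + linSum a′ s′) ∎
  where
  open ℤP.≤-Reasoning
  a₀ = a Fin.zero
  s₀ = s Fin.zero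
  a′ : Fin n → ℤ
  a′ i = a (suc i)
  s′ : Fin n → ℕ
  s′ i = s (suc i)
  -- Absorbing the first term shifts c to c + a₀ = c + σ₁.
  c′ = c + a₀
  expand : ∀ u b y l → (u + b) * y + l ≡ u * y + (b * y + l)
  expand = solve-∀
  shifted′-≥0 : ∀ j → + 0 ≤ c′ + σ a′ j
  shifted′-≥0 j = subst (+ 0 ≤_) (sym (ℤP.+-assoc c a₀ (σ a′ j))) (shifted-≥0 (suc j))
  induction = abel-shifted a′ s′ c′ s₀ L shifted′-≥0
    (λ i j p → noninc (suc i) (suc j) (s≤s p)) (λ i → lower (suc i))
    (λ i → noninc Fin.zero (suc i) z≤n) (lower Fin.zero)

abel : ∀ {n} (a : Fin n → ℤ) (s : Fin n → ℕ) (L : ℕ) →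
  (∀ j → + 0 ≤ σ a j) → Nonincreasing s → (∀ i → L ℕ.≤ s i) →
  σ a (fromℕ n) * + L ≤ linSum a s
abel {zero}  a s L _ _ _ = +≤+ z≤n
abel {suc n} a s L prefix-≥0 noninc lower =
  subst₂ _≤_ (cong (_* + L) (ℤP.+-identityˡ (σ a (fromℕ (suc n))))) (ℤP.+-identityˡ (linSum a s))
    (abel-shifted a s (+ 0) (s Fin.zero) L
      (λ j → subst (+ 0 ≤_) (sym (ℤP.+-identityˡ _)) (prefix-≥0 j))
      noninc lower (λ i → noninc Fin.zero i z≤n) (lower Fin.zero))

-- Necessity of condition (c)

swamped : ∀ v d → d ≤ -[1+ 0 ] → v + d * + suc ∣ v ∣ ≤ -[1+ 0 ]
swamped v d d≤-1 = begin
  v + d * + suc ∣ v ∣                 ≤⟨ ℤP.+-monoʳ-≤ v (ℤP.*-monoʳ-≤-nonNeg (+ suc ∣ v ∣) d≤-1) ⟩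
  v + -[1+ 0 ] * + suc ∣ v ∣          ≡⟨ regroup v (+ ∣ v ∣) ⟩
  (v - + ∣ v ∣) + -[1+ 0 ]            ≤⟨ ℤP.+-monoˡ-≤ -[1+ 0 ] (ℤP.i≤j⇒i-j≤0 (≤-abs v)) ⟩
  + 0 + -[1+ 0 ]                      ∎
  where
  open ℤP.≤-Reasoning
  regroup : ∀ u w → u + -[1+ 0 ] * (+ 1 + w) ≡ (u - w) + -[1+ 0 ]
  regroup = solve-∀
  ≤-abs : ∀ u → u ≤ + ∣ u ∣
  ≤-abs (+ n)    = ℤP.≤-refl
  ≤-abs -[1+ n ] = -≤+

-- (a) ⇒ prefix sums nonnegative: if σ_c < 0, a two-level sequence above the
-- conductor with a huge step t makes p negative.
prefix-nonneg : ∀ {n} (a : Fin n → ℤ) k m (Λ : Subset) → IsNumericalSemigroup Λ →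
  Admits Λ a k m → ∀ c → + 0 ≤ σ a c
prefix-nonneg {n} a k m Λ ns admits c with sign-split (σ a c)
... | inj₁ 0≤σc  = 0≤σc
... | inj₂ σc≤-1 = ⊥-elim (≤-1⇒∉ p≤-1 (admits s s∈Λ s>0 (twoLevel-nonincreasing c x t)))
  where
  open IsNumericalSemigroup ns
  N = proj₁ cofinite
  x = suc N
  v = σ a (fromℕ n) * + x + k * + m
  t = suc ∣ v ∣
  s = twoLevel c x t
  s∈Λ : ∀ i → Λ (s i)
  s∈Λ i = proj₂ cofinite (s i) (ℕP.≤-trans (ℕP.n≤1+n N) (twoLevel-≥ c x t i))
  s>0 : ∀ i → 0 < s i
  s>0 i = ℕP.<-≤-trans (s≤s z≤n) (twoLevel-≥ c x t i)
  p≤-1 : evalP a k m s ≤ -[1+ 0 ]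
  p≤-1 = subst (_≤ -[1+ 0 ]) (sym (evalP-twoLevel a k m c x t)) (swamped v (σ a c) σc≤-1)

descend : ∀ m (Λ : Subset) → (∀ t → 0 < t → Λ (m ℕ.+ t) → Λ t) →
  ∀ q → Λ (1 ℕ.+ m ℕ.* q) → Λ 1
descend m Λ strip zero    one+mq = subst Λ (cong suc (ℕP.*-zeroʳ m)) one+mq
descend m Λ strip (suc q) one+mq = descend m Λ strip q (strip (1 ℕ.+ m ℕ.* q) (s≤s z≤n)
  (subst Λ (trans (cong suc (ℕP.*-suc m q)) (sym (ℕP.+-suc m (m ℕ.* q)))) one+mq))

-- The hypothesis of the theorem supplies an index c with σ_c = 1 as soon as
-- σₙ + k = 0 (for k = -1 this is c = n).
unit-prefix : ∀ {n} (k : ℤ) (a : Fin n → ℤ) →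
  (k ≡ -[1+ 0 ] ⊎ ∃ λ (j : Fin n) → σ a (suc j) ≡ + 1) →
  σ a (fromℕ n) + k ≡ + 0 → ∃ λ (c : Fin (suc n)) → σ a c ≡ + 1
unit-prefix k a (inj₂ (j , σj≡1)) _ = suc j , σj≡1
unit-prefix {n} k a (inj₁ refl) σ+k≡0 =
  fromℕ n , trans (cancel (σ a (fromℕ n))) (cong (_- -[1+ 0 ]) σ+k≡0)
  where
  cancel : ∀ u → u ≡ (u + -[1+ 0 ]) - -[1+ 0 ]
  cancel = solve-∀

total-positive : ∀ {n} m → 1 < m → (k : ℤ) (a : Fin n → ℤ) →
  (k ≡ -[1+ 0 ] ⊎ ∃ λ (j : Fin n) → σ a (suc j) ≡ + 1) →
  (Λ : Subset) → IsNumericalSemigroup Λ → HasMultiplicity Λ m →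
  Admits Λ a k m → + 1 ≤ σ a (fromℕ n) + k
total-positive {n} m 1<m k a hyp Λ ns (0<m , m∈Λ , gaps) admits
  with positive-split (σ a (fromℕ n) + k)
... | inj₁ 1≤σ+k = 1≤σ+k
-- σₙ + k < 0: the constant sequence m is sent to (σₙ + k) m < 0.
... | inj₂ (inj₂ σ+k≤-1) =
  ⊥-elim (≤-1⇒∉ p≤-1 (admits s (λ _ → m∈Λ) (λ _ → 0<m) (twoLevel-nonincreasing Fin.zero m 0)))
  where
  s = twoLevel Fin.zero m 0
  open ℤP.≤-Reasoning
  p≤-1 : evalP a k m s ≤ -[1+ 0 ]
  p≤-1 = begin
    evalP a k m s                                        ≡⟨ evalP-twoLevel a k m Fin.zero m 0 ⟩
    (σ a (fromℕ n) * + m + k * + m) + + 0 * + 0          ≡⟨ ℤP.+-identityʳ _ ⟩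
    σ a (fromℕ n) * + m + k * + m                        ≡⟨ ℤP.*-distribʳ-+ (+ m) (σ a (fromℕ n)) k ⟨
    (σ a (fromℕ n) + k) * + m                            ≤⟨ ℤP.*-monoʳ-≤-nonNeg (+ m) σ+k≤-1 ⟩
    -[1+ 0 ] * + m                                       ≤⟨ neg-multiple m 0<m ⟩
    -[1+ 0 ]                                             ∎
    where
    neg-multiple : ∀ m → 0 < m → -[1+ 0 ] * + m ≤ -[1+ 0 ]
    neg-multiple (suc m′) _ = subst (_≤ -[1+ 0 ]) (sym (ℤP.*-identityˡ -[1+ m′ ])) (-≤- z≤n)
-- σₙ + k = 0: p strips m off any positive element, so the gap 1 lies in Λ.
... | inj₂ (inj₁ σ+k≡0) =
  ⊥-elim (gaps 1 (s≤s z≤n) 1<m (descend m Λ strip N (proj₂ cofinite _ N≤1+mN)))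
  where
  open IsNumericalSemigroup ns
  N = proj₁ cofinite
  N≤1+mN : N ℕ.≤ 1 ℕ.+ m ℕ.* N
  N≤1+mN = ℕP.≤-trans (ℕP.m≤n*m N m {{ℕ.>-nonZero 0<m}}) (ℕP.n≤1+n _)
  c = proj₁ (unit-prefix k a hyp σ+k≡0)
  σc≡1 = proj₂ (unit-prefix k a hyp σ+k≡0)
  strip : ∀ t → 0 < t → Λ (m ℕ.+ t) → Λ t
  strip t _ m+t∈Λ with admits s s∈Λ s>0 (twoLevel-nonincreasing c m t)
    where
    s = twoLevel c m t
    s∈Λ : ∀ i → Λ (s i)
    s∈Λ i with twoLevel-values c m t i
    ... | inj₁ eq = subst Λ (sym eq) m∈Λ
    ... | inj₂ eq = subst Λ (sym eq) m+t∈Λ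
    s>0 : ∀ i → 0 < s i
    s>0 i = ℕP.<-≤-trans 0<m (twoLevel-≥ c m t i)
  ... | y , p≡y , y∈Λ = subst Λ (ℤP.+-injective (trans (sym p≡y) p≡t)) y∈Λ
    where
    open ℤP.≤-Reasoning
    p≡t : evalP a k m (twoLevel c m t) ≡ + t
    p≡t = begin-equality
      evalP a k m (twoLevel c m t)                      ≡⟨ evalP-twoLevel a k m c m t ⟩
      (σ a (fromℕ n) * + m + k * + m) + σ a c * + t     ≡⟨ cong (_+ σ a c * + t) (ℤP.*-distribʳ-+ (+ m) (σ a (fromℕ n)) k) ⟨
      (σ a (fromℕ n) + k) * + m + σ a c * + t           ≡⟨ cong₂ (λ u w → u * + m + w * + t) σ+k≡0 σc≡1 ⟩
      + 0 * + m + + 1 * + t                             ≡⟨ ℤP.+-identityˡ (+ 1 * + t) ⟩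
      + 1 * + t                                         ≡⟨ ℤP.*-identityˡ (+ t) ⟩
      + t                                               ∎

-- The ordinary semigroup

ordinary-numerical : ∀ m → IsNumericalSemigroup (Ordinary m)
ordinary-numerical m = record
  { has-zero = inj₁ refl ; closed = closed ; cofinite = m , λ _ m≤x → inj₂ m≤x }
  where
  closed : ∀ x y → Ordinary m x → Ordinary m y → Ordinary m (x ℕ.+ y)
  closed x y (inj₁ refl) y∈ = y∈
  closed x y (inj₂ m≤x)  _  = inj₂ (ℕP.≤-trans m≤x (ℕP.m≤m+n x y))

ordinary-multiplicity : ∀ m → 0 < m → HasMultiplicity (Ordinary m) m
ordinary-multiplicity m 0<m = 0<m , inj₂ ℕP.≤-refl , gap
  where
  gap : ∀ x → 0 < x → x < m → ¬ Ordinary m x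
  gap x 0<x _   (inj₁ refl) = ℕP.<-irrefl refl 0<x
  gap x _   x<m (inj₂ m≤x)  = ℕP.<-irrefl refl (ℕP.<-≤-trans x<m m≤x)

≥m⇒∈ordinary : ∀ {m} z → + m ≤ z → z ∈ℤ Ordinary m
≥m⇒∈ordinary (+ y) (+≤+ m≤y) = y , refl , inj₂ m≤y

-- (c) ⇒ (b): by Abel's inequality with L = m, p(s) ≥ (σₙ + k) m ≥ m.
ordinary-admits : ∀ {n} m k (a : Fin n → ℤ) →
  (∀ (j : Fin (suc n)) → + 0 ≤ σ a j) → + 1 ≤ σ a (fromℕ n) + k →
  Admits (Ordinary m) a k m
ordinary-admits {n} m k a prefix-≥0 1≤σ+k s s∈ s>0 noninc = ≥m⇒∈ordinary _ m≤p
  where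
  s≥m : ∀ i → m ℕ.≤ s i
  s≥m i with s∈ i
  ... | inj₁ sᵢ≡0 = ⊥-elim (ℕP.<⇒≢ (s>0 i) (sym sᵢ≡0))
  ... | inj₂ m≤sᵢ = m≤sᵢ
  open ℤP.≤-Reasoning
  m≤p : + m ≤ evalP a k m s
  m≤p = begin
    + m                                ≡⟨ ℤP.*-identityˡ (+ m) ⟨
    + 1 * + m                          ≤⟨ ℤP.*-monoʳ-≤-nonNeg (+ m) 1≤σ+k ⟩
    (σ a (fromℕ n) + k) * + m          ≡⟨ ℤP.*-distribʳ-+ (+ m) (σ a (fromℕ n)) k ⟩
    σ a (fromℕ n) * + m + k * + m      ≤⟨ ℤP.+-monoˡ-≤ (k * + m) (abel a s m prefix-≥0 noninc s≥m) ⟩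
    linSum a s + k * + m               ∎

mainTheorem2 : (m : ℕ) → 1 < m → (k : ℤ) → k ≢ + 0 →
    (n : ℕ) → (a : Fin n → ℤ) → (∀ i → a i ≢ + 0) →
    (k ≡ -[1+ 0 ] ⊎ ∃ λ (j : Fin n) → σ a (suc j) ≡ + 1) →
    ((∃ λ (Λ : Subset) → IsNumericalSemigroup Λ × HasMultiplicity Λ m × Admits Λ a k m)
    ⇔ Admits (Ordinary m) a k m)
    × (Admits (Ordinary m) a k m
    ⇔ ((∀ (j : Fin (ℕ.suc n)) → + 0 ≤ σ a j) × (+ 1 ≤ σ a (fromℕ n) + k)))
mainTheorem2 m 1<m k _ n a _ hyp =
  mk⇔ (λ (Λ , ns , mult , adm) → c⇒b (a⇒c Λ ns mult adm)) b⇒a ,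
  mk⇔ (a⇒c (Ordinary m) (ordinary-numerical m) (ordinary-multiplicity m 0<m)) c⇒b
  where
  0<m : 0 < m
  0<m = ℕP.<-trans (s≤s z≤n) 1<m
  Condition = (∀ (j : Fin (ℕ.suc n)) → + 0 ≤ σ a j) × (+ 1 ≤ σ a (fromℕ n) + k)
  a⇒c : (Λ : Subset) → IsNumericalSemigroup Λ → HasMultiplicity Λ m → Admits Λ a k m → Condition
  a⇒c Λ ns mult adm = prefix-nonneg a k m Λ ns adm , total-positive m 1<m k a hyp Λ ns mult adm
  c⇒b : Condition → Admits (Ordinary m) a k m
  c⇒b (prefix-≥0 , 1≤σ+k) = ordinary-admits m k a prefix-≥0 1≤σ+k
  b⇒a : Admits (Ordinary m) a k m →
    ∃ λ (Λ : Subset) → IsNumericalSemigroup Λ × HasMultiplicity Λ m × Admits Λ a k m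
  b⇒a adm = Ordinary m , ordinary-numerical m , ordinary-multiplicity m 0<m , adm
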